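{- Let $p\in\mathbb{Z}_{\ge1}$ and let $S$ be a non-empty $p$-symmetric set of positive integers. In Ending Partizan Subtraction Nim with removable set $S$ and any terminal rule $W$, $p$ is a period of the outcome sequence: there exists $A\in\mathbb{Z}_{\ge0}$ such that $\mathcal{O}_S(m+p)=\mathcal{O}_S(m)$ for all $m\ge A$.
   Context: A non-empty set $S\subseteq\mathbb{Z}_{\ge1}$ is $p$-symmetric if $p-s\in S$ for all $s\in S$. Ending Partizan Subtraction Nim with removable set $S$ and terminal rule $W$: a position is a number $n\in\mathbb{Z}_{\ge0}$ of tokens; players Left and Right alternate, a move from $n$ removes $s\in S$ tokens with $s\le n$. Positions with no move (i.e. $n<\min S$) are terminal, and $W$ assigns to each terminal position a value in $\{\mathcal{L},\mathcal{R},\mathcal{N},\mathcal{P}\}$: if the game ends at terminal $n$, then Left wins if $W(n)=\mathcal{L}$, Right wins if $W(n)=\mathcal{R}$, the player to move loses if $W(n)=\mathcal{P}$, and the player to move wins if $W(n)=\mathcal{N}$. The outcome $\mathcal{O}_S(n)$ is $\mathcal{L}$ (resp. $\mathcal{R}$) if Left (resp. Right) has a winning strategy from $n$ both moving first and moving second, $\mathcal{N}$ if the first player (whichever) has a winning strategy, and $\mathcal{P}$ if the second player (whichever) has one. -}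

module Defs where

open import Data.Nat using (ℕ; _≤_; _<_; _∸_; _+_)
open import Data.Product using (Σ; _×_; ∃)
open import Data.Sum using (_⊎_)
open import Relation.Binary.PropositionalEquality using (_≡_)

data Outcome : Set where
  𝓛 𝓡 𝓝 𝓟 : Outcome

data Player : Set where
  Left Right : Player

opp : Player → Player
opp Left  = Right
opp Right = Left

-- S is p-symmetric: p - s ∈ S for all s ∈ S  (p - s taken in ℤ, so this says
-- there is t ∈ S with t + s = p).
PSymmetric : ℕ → (ℕ → Set) → Set
PSymmetric p S = ∀ s → S s → Σ ℕ λ t → S t × t + s ≡ p

Terminal : (ℕ → Set) → ℕ → Set
Terminal S n = ∀ s → S s → n < s

-- the player X to move at a terminal position with rule value o wins / loses
data TermWin : Player → Outcome → Set where
  tw-L : TermWin Left 𝓛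
  tw-R : TermWin Right 𝓡
  tw-N : ∀ {X} → TermWin X 𝓝

data TermLose : Player → Outcome → Set where
  tl-L : TermLose Right 𝓛
  tl-R : TermLose Left 𝓡
  tl-P : ∀ {X} → TermLose X 𝓟

mutual
  data Wins (S : ℕ → Set) (W : ℕ → Outcome) : Player → ℕ → Set where
    win-term : ∀ {X n} → Terminal S n → TermWin X (W n) → Wins S W X n
    win-move : ∀ {X n} s → S s → s ≤ n → Loses S W (opp X) (n ∸ s) → Wins S W X n

  data Loses (S : ℕ → Set) (W : ℕ → Outcome) : Player → ℕ → Set where
    lose-term : ∀ {X n} → Terminal S n → TermLose X (W n) → Loses S W X n
    lose-move : ∀ {X n} s → S s → s ≤ n →
                (∀ s′ → S s′ → s′ ≤ n → Wins S W (opp X) (n ∸ s′)) → Loses S W X n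

HasOutcome : (ℕ → Set) → (ℕ → Outcome) → ℕ → Outcome → Set
HasOutcome S W n 𝓛 = Wins S W Left n × Loses S W Right n
HasOutcome S W n 𝓡 = Wins S W Right n × Loses S W Left n
HasOutcome S W n 𝓝 = Wins S W Left n × Wins S W Right n
HasOutcome S W n 𝓟 = Loses S W Left n × Loses S W Right n

-- Mirror strategy: if the player to move loses at m, they also lose at m + p, since the
-- opponent answers every removal s with the removal p − s ∈ S and so returns to m. A
-- winning first move from n ≥ p stays winning from n + p for the same reason, and no
-- position n ≥ p is terminal because S contains an element below p. Determinacy and the
-- fact that a position cannot be both won and lost for the mover turn these two
-- implications into equivalences for all m ≥ p.
module Submission where

open import Defs
open import Data.Nat using (ℕ; suc; _≤_; _<_; _+_; _∸_; s≤s; _≤?_)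
open import Data.Nat.Properties
  using (≤-trans; <⇒≤; <⇒≱; m≤m+n; m≤n+m; +-monoˡ-≤; ∸-monoʳ-<; +-∸-comm; +-assoc; m+n∸n≡m; ≰⇒>; anyUpTo?)
open import Data.Nat.Induction using (<-rec)
open import Data.Product using (_×_; ∃; _,_)
open import Data.Product.Function.NonDependent.Propositional using (_×-⇔_)
open import Data.Sum using (_⊎_; inj₁; inj₂; [_,_]; map)
open import Data.Empty using (⊥-elim)
open import Function using (id)
open import Function.Bundles using (_⇔_; mk⇔)
open import Relation.Nullary using (¬_; yes; no)
open import Relation.Unary using (Decidable)
open import Relation.Binary.PropositionalEquality using (_≡_; refl; sym; trans; cong; subst; subst₂)

opp-involutive : ∀ X → opp (opp X) ≡ X
opp-involutive Left  = refl
opp-involutive Right = refl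

termWin⊎termLose : ∀ X o → TermWin X o ⊎ TermLose X o
termWin⊎termLose Left  𝓛 = inj₁ tw-L
termWin⊎termLose Left  𝓡 = inj₂ tl-R
termWin⊎termLose Left  𝓝 = inj₁ tw-N
termWin⊎termLose Left  𝓟 = inj₂ tl-P
termWin⊎termLose Right 𝓛 = inj₂ tl-L
termWin⊎termLose Right 𝓡 = inj₁ tw-R
termWin⊎termLose Right 𝓝 = inj₁ tw-N
termWin⊎termLose Right 𝓟 = inj₂ tl-P

termWin⇒¬termLose : ∀ {X o} → TermWin X o → ¬ TermLose X o
termWin⇒¬termLose tw-L ()
termWin⇒¬termLose tw-R ()
termWin⇒¬termLose tw-N ()

terminal⊎move : ∀ {S} → Decidable S → ∀ n → Terminal S n ⊎ ∃ λ s → S s × s ≤ n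
terminal⊎move S? n with anyUpTo? S? (suc n)
... | yes (s , s≤s s≤n , Ss) = inj₂ (s , Ss , s≤n)
... | no noMove              = inj₁ λ s Ss → ≰⇒> λ s≤n → noMove (s , s≤s s≤n , Ss)

module Game (S : ℕ → Set) (W : ℕ → Outcome) where

  wins⇒¬loses : ∀ {X n} → Wins S W X n → ¬ Loses S W X n
  wins⇒¬loses (win-term _ w)         (lose-term _ l)         = termWin⇒¬termLose w l
  wins⇒¬loses (win-term t _)         (lose-move s Ss s≤n _) = <⇒≱ (t s Ss) s≤n
  wins⇒¬loses (win-move s Ss s≤n _) (lose-term t _)         = <⇒≱ (t s Ss) s≤n
  wins⇒¬loses (win-move s Ss s≤n l) (lose-move _ _ _ w)    = wins⇒¬loses (w s Ss s≤n) l

  WinningMove : Player → ℕ → ℕ → Set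
  WinningMove X n s = S s × s ≤ n × Loses S W (opp X) (n ∸ s)

  module _ (S? : Decidable S) (S-positive : ∀ s → S s → 1 ≤ s) where

    Determined : ℕ → Set
    Determined n = ∀ X → Wins S W X n ⊎ Loses S W X n

    move-decreases : ∀ {n s} → S s → s ≤ n → n ∸ s < n
    move-decreases Ss s≤n = ∸-monoʳ-< (S-positive _ Ss) s≤n

    winningMove? : ∀ {n} → (∀ m → m < n → Determined m) → ∀ X → Decidable (WinningMove X n)
    winningMove? {n} ih X s with S? s | s ≤? n
    ... | no ¬Ss | _       = no λ (Ss , _) → ¬Ss Ss
    ... | yes _  | no s≰n  = no λ (_ , s≤n , _) → s≰n s≤n
    ... | yes Ss | yes s≤n with ih (n ∸ s) (move-decreases Ss s≤n) (opp X)
    ...   | inj₁ w = no λ (_ , _ , l) → wins⇒¬loses w l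
    ...   | inj₂ l = yes (Ss , s≤n , l)

    determined-step : ∀ n → (∀ m → m < n → Determined m) → Determined n
    determined-step n ih X with terminal⊎move S? n
    ... | inj₁ term = map (win-term term) (lose-term term) (termWin⊎termLose X (W n))
    ... | inj₂ (s₀ , Ss₀ , s₀≤n) with anyUpTo? (winningMove? ih X) (suc n)
    ...   | yes (s , _ , Ss , s≤n , l) = inj₁ (win-move s Ss s≤n l)
    ...   | no noWinningMove = inj₂ (lose-move s₀ Ss₀ s₀≤n opponentWins)
      where
      opponentWins : ∀ s → S s → s ≤ n → Wins S W (opp X) (n ∸ s)
      opponentWins s Ss s≤n =
        [ id , (λ l → ⊥-elim (noWinningMove (s , s≤s s≤n , Ss , s≤n , l))) ]
          (ih (n ∸ s) (move-decreases Ss s≤n) (opp X))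

    determined : ∀ n → Determined n
    determined = <-rec Determined λ n ih → determined-step n λ m m<n → ih m<n

  module _ (p : ℕ) (symmetric : PSymmetric p S) (S-positive : ∀ s → S s → 1 ≤ s)
           (s₀ : ℕ) (Ss₀ : S s₀) where

    element<p : ∀ {s} → S s → s < p
    element<p {s} Ss with symmetric s Ss
    ... | t , St , t+s≡p = subst (s <_) t+s≡p (+-monoˡ-≤ s (S-positive t St))

    p≤⇒¬terminal : ∀ {n} → p ≤ n → ¬ Terminal S n
    p≤⇒¬terminal p≤n term = <⇒≱ (term s₀ Ss₀) (≤-trans (<⇒≤ (element<p Ss₀)) p≤n)

    loses-+p : ∀ {X m} → Loses S W X m → Loses S W X (m + p)
    loses-+p {X} {m} l = lose-move s₀ Ss₀ (≤-trans (<⇒≤ (element<p Ss₀)) (m≤n+m p m)) mirror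
      where
      mirror : ∀ s → S s → s ≤ m + p → Wins S W (opp X) (m + p ∸ s)
      mirror s Ss _ with symmetric s Ss
      ... | t , St , refl =
        subst (Wins S W (opp X)) (sym m+[t+s]∸s≡m+t)
          (win-move t St (m≤n+m t m)
            (subst₂ (Loses S W) (sym (opp-involutive X)) (sym (m+n∸n≡m m t)) l))
        where
        m+[t+s]∸s≡m+t : m + (t + s) ∸ s ≡ m + t
        m+[t+s]∸s≡m+t = trans (cong (_∸ s) (sym (+-assoc m t s))) (m+n∸n≡m (m + t) s)

    wins-+p : ∀ {X n} → p ≤ n → Wins S W X n → Wins S W X (n + p)
    wins-+p p≤n (win-term term _)   = ⊥-elim (p≤⇒¬terminal p≤n term)
    wins-+p {n = n} _ (win-move s Ss s≤n l) =
      win-move s Ss (≤-trans s≤n (m≤m+n n p))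
        (subst (Loses S W _) (sym (+-∸-comm p s≤n)) (loses-+p l))

    module _ (S? : Decidable S) where

      wins-periodic : ∀ X {m} → p ≤ m → Wins S W X (m + p) ⇔ Wins S W X m
      wins-periodic X {m} p≤m = mk⇔ fromShifted (wins-+p p≤m)
        where
        fromShifted : Wins S W X (m + p) → Wins S W X m
        fromShifted w = [ id , (λ l → ⊥-elim (wins⇒¬loses w (loses-+p l))) ]
                          (determined S? S-positive m X)

      loses-periodic : ∀ X {m} → p ≤ m → Loses S W X (m + p) ⇔ Loses S W X m
      loses-periodic X {m} p≤m = mk⇔ fromShifted loses-+p
        where
        fromShifted : Loses S W X (m + p) → Loses S W X m
        fromShifted l = [ (λ w → ⊥-elim (wins⇒¬loses (wins-+p p≤m w) l)) , id ]
                          (determined S? S-positive m X)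

      outcome-periodic : ∀ {m} → p ≤ m → ∀ o → HasOutcome S W (m + p) o ⇔ HasOutcome S W m o
      outcome-periodic p≤m 𝓛 = wins-periodic Left p≤m ×-⇔ loses-periodic Right p≤m
      outcome-periodic p≤m 𝓡 = wins-periodic Right p≤m ×-⇔ loses-periodic Left p≤m
      outcome-periodic p≤m 𝓝 = wins-periodic Left p≤m ×-⇔ wins-periodic Right p≤m
      outcome-periodic p≤m 𝓟 = loses-periodic Left p≤m ×-⇔ loses-periodic Right p≤m

-- The hypothesis 1 ≤ p is redundant: element<p derives it from the others.
theorem11 : (p : ℕ) → 1 ≤ p → (S : ℕ → Set) → Decidable S →
            (∀ s → S s → 1 ≤ s) → (∃ λ s → S s) → PSymmetric p S →
            (W : ℕ → Outcome) →
            ∃ λ A → ∀ m → A ≤ m → ∀ o → HasOutcome S W (m + p) o ⇔ HasOutcome S W m o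
theorem11 p _ S S? S-positive (s₀ , Ss₀) symmetric W =
  p , λ m → Game.outcome-periodic S W p symmetric S-positive s₀ Ss₀ S?
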